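{- Let $n\ge 4$ be even and let $\mathcal{F}=\{F_0,\ldots,F_{n+2}\}$ with $F_0=[n]$, $F_i=[n]\setminus\{i\}$ for $1\le i\le n$, $F_{n+1}=[n]\setminus\{1,2\}$, $F_{n+2}=[n]\setminus\{3,4\}$. Let $\mathcal{S}=\{S_0,\ldots,S_{n+2}\}\subseteq\mathcal{P}([n])$ be a family that satisfies Reimer's conditions via $\mathcal{F}$ and the bijection $S_i\mapsto F_i$ and does not satisfy the abundance condition, and let $x$ be the smallest size of a member of $\mathcal{S}$. If $n=4x+4$, then each element of $[n]$ belongs to exactly $\frac n2+1$ members of $\mathcal{S}$.
   Context: $[n]=\{1,\ldots,n\}$. For $A\subseteq B\subseteq[n]$, $[A,B]=\{C: A\subseteq C\subseteq B\}$. $\mathcal{S}$ satisfies Reimer's conditions via the filter $\mathcal{F}$ and a bijection $A\mapsto F_A$ from $\mathcal{S}$ to $\mathcal{F}$ if (1) $A\subseteq F_A$ for all $A\in\mathcal{S}$, and (2) for distinct $A,B\in\mathcal{S}$, $[A,F_A]\cap[B,F_B]=\emptyset$. A family satisfies the abundance condition if some element belongs to at least half of its member sets. -}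

module Defs where

open import Data.Bool using (Bool; true; false; not; if_then_else_; _∨_)
open import Data.Nat using (ℕ; zero; suc; _+_; _*_; _≤_; _<ᵇ_; _≡ᵇ_; _≤ᵇ_)
open import Data.Fin using (Fin; toℕ)
open import Data.Fin.Subset using (Subset; _⊆_; ∣_∣)
open import Data.Vec using (tabulate; lookup)
open import Data.Product using (_×_; ∃)
open import Relation.Nullary using (¬_)
open import Relation.Binary.PropositionalEquality using (_≡_)

-- Ground set [n] = {1,…,n} is represented by Fin n; paper element k ↔ index k-1.
-- Indices of the family run over Fin (n + 3) ↔ {0,…,n+2}.

fMem : ℕ → ℕ → ℕ → Bool
fMem n zero    a = true
fMem n (suc j) a =
  if j <ᵇ n then not (a ≡ᵇ j)                   -- F_{j+1} = [n] \ {j+1}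
  else if j ≡ᵇ n then (2 ≤ᵇ a)                  -- F_{n+1} = [n] \ {1,2}
  else not ((a ≡ᵇ 2) ∨ (a ≡ᵇ 3))                -- F_{n+2} = [n] \ {3,4}

𝓕 : (n : ℕ) → Fin (n + 3) → Subset n
𝓕 n j = tabulate (λ a → fMem n (toℕ j) (toℕ a))

InInterval : {n : ℕ} → Subset n → Subset n → Subset n → Set
InInterval A B C = A ⊆ C × C ⊆ B

ReimerConditions : {n m : ℕ} → (Fin m → Subset n) → (Fin m → Subset n) → Set
ReimerConditions {n} {m} S F =
  ((i : Fin m) → S i ⊆ F i) ×
  ((i j : Fin m) → ¬ (i ≡ j) → ¬ (∃ λ (C : Subset n) → InInterval (S i) (F i) C × InInterval (S j) (F j) C))

degree : {n m : ℕ} → (Fin m → Subset n) → Fin n → ℕ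
degree S a = ∣ tabulate (λ j → lookup (S j) a) ∣

Abundant : {n m : ℕ} → (Fin m → Subset n) → Set
Abundant {n} {m} S = ∃ λ (a : Fin n) → m ≤ 2 * degree S a

{-# OPTIONS --safe #-}
-- Reimer's conditions say that for distinct i, j the set S_i ∪ S_j cannot lie below both F_i and
-- F_j, i.e. S_i ⊈ F_j or S_j ⊈ F_i.  Against F_0 = [n] this forces S_0 = [n]; against
-- F_a = [n] ∖ {a} it makes S_1, …, S_n a tournament (b ∈ S_a or a ∈ S_b), in which 1, 2 and 3, 4
-- beat each other because F_{n+1} ⊆ F_1, F_2 and F_{n+2} ⊆ F_3, F_4.  So Σ_a |S_a| ≥ n(n-1)/2 + 2,
-- and with |S_{n+1}|, |S_{n+2}| ≥ x the degrees sum to at least n + n(n-1)/2 + 2 + 2x = n(n/2 + 1)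
-- when n = 4x + 4.  Non-abundance caps every degree at n/2 + 1, so all of them equal n/2 + 1.
module Submission where

open import Defs
open import Data.Nat using (ℕ; _+_; _*_; _≤_; _/_)
open import Data.Nat.Divisibility using (_∣_)
open import Data.Fin using (Fin)
open import Data.Fin.Subset using (Subset; ∣_∣)
open import Data.Product using (_×_; ∃)
open import Function.Definitions using (Injective)
open import Relation.Binary.PropositionalEquality using (_≡_)
open import Relation.Nullary using (¬_)

open import Data.Bool using (Bool; true; false; not; _∨_)
open import Data.Bool.Properties using (T-≡)
open import Data.Fin using (zero; suc; toℕ; cast; _↑ˡ_; _↑ʳ_; punchIn; punchOut)
open import Data.Fin.Patterns using (0F; 1F; 2F; 3F)
open import Data.Fin.Properties using (toℕ-cast; cast-is-id; toℕ-↑ˡ; toℕ-↑ʳ; toℕ-injective; toℕ<n; punchInᵢ≢i; punchIn-punchOut)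
open import Data.Fin.Subset using (_∈_; _∉_; _⊆_; _⊈_; _∪_; ⊤)
open import Data.Fin.Subset.Properties using (_∈?_; p⊆p∪q; q⊆p∪q; x∈p∪q⁻; p⊆q⇒∣p∣≤∣q∣; ∣⊤∣≡n)
open import Data.Nat using (zero; suc; _<_; _≡ᵇ_; _<ᵇ_; _≤ᵇ_; z≤n; s≤s)
open import Data.Empty using (⊥-elim)
open import Data.Nat.DivMod using (m*n/n≡m)
open import Data.Nat.Properties
open import Algebra.Properties.CommutativeMonoid.Sum +-0-commutativeMonoid
open import Data.Nat.Tactic.RingSolver using (solve-∀)
open import Data.Product using (_,_; proj₁)
open import Data.Sum using (_⊎_; inj₁; inj₂; [_,_]; swap)
open import Data.Vec using (_∷_; []; lookup; tabulate)
open import Data.Vec.Properties using ([]=⇒lookup; lookup⇒[]=; lookup∘tabulate)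
open import Data.Vec.Functional using (removeAt)
open import Function using (_∘_; case_of_; Equivalence)
open import Relation.Binary.PropositionalEquality using (refl; sym; trans; cong; cong₂; subst; _≢_; module ≡-Reasoning)
open import Relation.Nullary using (yes; no; contradiction)

∑-const : ∀ n c → ∑[ i < n ] c ≡ n * c
∑-const zero    c = refl
∑-const (suc n) c = cong (c +_) (∑-const n c)

∑-mono-≤ : ∀ {n} {f g : Fin n → ℕ} → (∀ i → f i ≤ g i) → sum f ≤ sum g
∑-mono-≤ {zero}  _   = z≤n
∑-mono-≤ {suc n} f≤g = +-mono-≤ (f≤g zero) (∑-mono-≤ (f≤g ∘ suc))

∑-mono-< : ∀ {n} {f g : Fin n → ℕ} → (∀ i → f i ≤ g i) → ∀ i → f i < g i → sum f < sum g
∑-mono-< f≤g zero    fi<gi = +-mono-<-≤ fi<gi (∑-mono-≤ (f≤g ∘ suc))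
∑-mono-< f≤g (suc i) fi<gi = +-mono-≤-< (f≤g zero) (∑-mono-< (f≤g ∘ suc) i fi<gi)

∑-cast : ∀ {m n} (eq : m ≡ n) (f : Fin n → ℕ) → sum f ≡ sum (f ∘ cast eq)
∑-cast refl f = sum-cong-≗ (λ i → cong f (sym (cast-is-id refl i)))

∑-↑ : ∀ m {n} (f : Fin (m + n) → ℕ) → sum f ≡ sum (f ∘ (_↑ˡ n)) + sum (f ∘ (m ↑ʳ_))
∑-↑ zero    f = refl
∑-↑ (suc m) f = trans (cong (f zero +_) (∑-↑ m (f ∘ suc))) (sym (+-assoc (f zero) _ _))

≤-∑-saturated : ∀ {n} {f : Fin n → ℕ} {B} → (∀ i → f i ≤ B) → n * B ≤ sum f → ∀ i → f i ≡ B
≤-∑-saturated {n} {f} {B} f≤B nB≤∑f i = ≤-antisym (f≤B i) (≮⇒≥ λ fi<B →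
  <⇒≱ (subst (sum f <_) (∑-const n B) (∑-mono-< f≤B i fi<B)) nB≤∑f)

∑-removeAt-≤ : ∀ {n} (f : Fin (suc n) → ℕ) i → sum (removeAt f i) ≤ sum f
∑-removeAt-≤ f i = subst (sum (removeAt f i) ≤_) (sym (sum-remove {i = i} f)) (m≤n+m _ (f i))

∑-punctured-≥ : ∀ {n} (f : Fin (suc n) → ℕ) i → (∀ j → j ≢ i → 1 ≤ f j) → n ≤ sum f
∑-punctured-≥ {n} f i 1≤f = begin
  n                    ≡⟨ trans (sym (*-identityʳ n)) (sym (∑-const n 1)) ⟩
  ∑[ j < n ] 1         ≤⟨ ∑-mono-≤ (λ j → 1≤f (punchIn i j) (punchInᵢ≢i i j)) ⟩
  sum (removeAt f i)   ≤⟨ ∑-removeAt-≤ f i ⟩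
  sum f                ∎
  where open ≤-Reasoning

∑-punctured-> : ∀ {n} (f : Fin (suc n) → ℕ) i → (∀ j → j ≢ i → 1 ≤ f j) →
                ∀ c → c ≢ i → 2 ≤ f c → suc n ≤ sum f
∑-punctured-> {n} f i 1≤f c c≢i 2≤fc = begin
  suc n                ≡⟨ cong suc (trans (sym (*-identityʳ n)) (sym (∑-const n 1))) ⟩
  suc (∑[ j < n ] 1)   ≤⟨ ∑-mono-< (λ j → 1≤f (punchIn i j) (punchInᵢ≢i i j)) c′ 1<f[c′] ⟩
  sum (removeAt f i)   ≤⟨ ∑-removeAt-≤ f i ⟩
  sum f                ∎
  where
  open ≤-Reasoning
  c′ = punchOut (c≢i ∘ sym)
  1<f[c′] : 1 < f (punchIn i c′)
  1<f[c′] = subst (λ k → 1 < f k) (sym (punchIn-punchOut (c≢i ∘ sym))) 2≤fc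

χ : Bool → ℕ
χ true  = 1
χ false = 0

∈⇒χ≡1 : ∀ {n} {p : Subset n} {x} → x ∈ p → χ (lookup p x) ≡ 1
∈⇒χ≡1 x∈p = cong χ ([]=⇒lookup x∈p)

∣p∣≡∑χ : ∀ {n} (p : Subset n) → ∣ p ∣ ≡ ∑[ i < n ] χ (lookup p i)
∣p∣≡∑χ []          = refl
∣p∣≡∑χ (true  ∷ p) = cong suc (∣p∣≡∑χ p)
∣p∣≡∑χ (false ∷ p) = ∣p∣≡∑χ p

∑degree≡∑∣S∣ : ∀ {n m} (S : Fin m → Subset n) → ∑[ a < n ] degree S a ≡ ∑[ j < m ] ∣ S j ∣
∑degree≡∑∣S∣ {n} {m} S = begin
  ∑[ a < n ] degree S a                       ≡⟨ sum-cong-≗ degree≡∑ ⟩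
  ∑[ a < n ] ∑[ j < m ] χ (lookup (S j) a)    ≡⟨ ∑-comm (λ a j → χ (lookup (S j) a)) ⟩
  ∑[ j < m ] ∑[ a < n ] χ (lookup (S j) a)    ≡⟨ sum-cong-≗ (sym ∘ ∣p∣≡∑χ ∘ S) ⟩
  ∑[ j < m ] ∣ S j ∣                          ∎
  where
  open ≡-Reasoning
  degree≡∑ : ∀ a → degree S a ≡ ∑[ j < m ] χ (lookup (S j) a)
  degree≡∑ a = trans (∣p∣≡∑χ (tabulate (λ j → lookup (S j) a)))
                     (sum-cong-≗ (λ j → cong χ (lookup∘tabulate (λ j → lookup (S j) a) j)))

module _ {n} (T : Fin (suc n) → Subset (suc n)) where

  incidences : Fin (suc n) → ℕ
  incidences a = ∑[ b < suc n ] (χ (lookup (T a) b) + χ (lookup (T b) a))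

  ∑incidences≡ : sum incidences ≡ 2 * ∑[ a < suc n ] ∣ T a ∣
  ∑incidences≡ = begin
    sum incidences
      ≡⟨ sum-cong-≗ (λ a → ∑-distrib-+ (χ ∘ lookup (T a)) (λ b → χ (lookup (T b) a))) ⟩
    ∑[ a < suc n ] (M a + ∑[ b < suc n ] χ (lookup (T b) a))
      ≡⟨ ∑-distrib-+ M (λ a → ∑[ b < suc n ] χ (lookup (T b) a)) ⟩
    sum M + ∑[ a < suc n ] ∑[ b < suc n ] χ (lookup (T b) a)
      ≡⟨ cong (sum M +_) (∑-comm (λ a b → χ (lookup (T b) a))) ⟩
    sum M + sum M
      ≡⟨ cong (λ s → s + s) (sum-cong-≗ (sym ∘ ∣p∣≡∑χ ∘ T)) ⟩
    ∑∣T∣ + ∑∣T∣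
      ≡⟨ cong (∑∣T∣ +_) (+-identityʳ ∑∣T∣) ⟨
    2 * ∑∣T∣ ∎
    where
    open ≡-Reasoning
    M : Fin (suc n) → ℕ
    M a = ∑[ b < suc n ] χ (lookup (T a) b)
    ∑∣T∣ : ℕ
    ∑∣T∣ = ∑[ a < suc n ] ∣ T a ∣

  module _ (total : ∀ {a b} → a ≢ b → b ∈ T a ⊎ a ∈ T b) where

    1≤pair : ∀ {a b} → b ≢ a → 1 ≤ χ (lookup (T a) b) + χ (lookup (T b) a)
    1≤pair {a} {b} b≢a with total (b≢a ∘ sym)
    ... | inj₁ b∈Ta = subst (λ k → 1 ≤ k + χ (lookup (T b) a)) (sym (∈⇒χ≡1 b∈Ta)) (s≤s z≤n)
    ... | inj₂ a∈Tb = subst (λ k → 1 ≤ χ (lookup (T a) b) + k) (sym (∈⇒χ≡1 a∈Tb)) (m≤n+m 1 _)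

    n≤incidences : ∀ a → n ≤ incidences a
    n≤incidences a = ∑-punctured-≥ _ a (λ _ → 1≤pair)

    mutual⇒n<incidences : ∀ {a c} → c ≢ a → c ∈ T a → a ∈ T c → n < incidences a
    mutual⇒n<incidences {a} {c} c≢a c∈Ta a∈Tc = ∑-punctured-> _ a (λ _ → 1≤pair) c c≢a
      (≤-reflexive (sym (cong₂ _+_ (∈⇒χ≡1 c∈Ta) (∈⇒χ≡1 a∈Tc))))

reimer-⊈ : ∀ {n m} {S F : Fin m → Subset n} → ReimerConditions S F →
           ∀ {i j} → i ≢ j → S j ⊆ F i → S i ⊈ F j
reimer-⊈ {S = S} {F} (S⊆F , disjoint) {i} {j} i≢j Sj⊆Fi Si⊆Fj =
  disjoint i j i≢j (S i ∪ S j , (p⊆p∪q (S j) , ∪⊆ (S⊆F i) Sj⊆Fi) , (q⊆p∪q (S i) (S j) , ∪⊆ Si⊆Fj (S⊆F j)))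
  where
  ∪⊆ : ∀ {r} → S i ⊆ r → S j ⊆ r → S i ∪ S j ⊆ r
  ∪⊆ Si⊆r Sj⊆r = [ Si⊆r , Sj⊆r ] ∘ x∈p∪q⁻ (S i) (S j)

lookup≡false⇒∉ : ∀ {n} {p : Subset n} {x} → lookup p x ≡ false → x ∉ p
lookup≡false⇒∉ p[x]≡false x∈p = case trans (sym p[x]≡false) ([]=⇒lookup x∈p) of λ ()

≢⇒≡ᵇ≡false : ∀ {m n} → m ≢ n → (m ≡ᵇ n) ≡ false
≢⇒≡ᵇ≡false {m} {n} m≢n with m ≡ᵇ n | ≡ᵇ⇒≡ m n
... | false | _    = refl
... | true  | m≡n = contradiction (m≡n _) m≢n

fMem-elem : ∀ {a} n e → a < n → fMem n (suc a) e ≡ not (e ≡ᵇ a)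
fMem-elem {a} n e a<n with a <ᵇ n | <⇒<ᵇ a<n
... | true | _ = refl

fMem-n+1 : ∀ n e → fMem n (suc n) e ≡ (2 ≤ᵇ e)
fMem-n+1 n e with n <ᵇ n | <ᵇ⇒< n n | n ≡ᵇ n | ≡⇒≡ᵇ n n refl
... | true  | n<n | _    | _ = contradiction (n<n _) (n≮n n)
... | false | _   | true | _ = refl

fMem-n+2 : ∀ n e → fMem n (suc (suc n)) e ≡ not ((e ≡ᵇ 2) ∨ (e ≡ᵇ 3))
fMem-n+2 n e with suc n <ᵇ n | <ᵇ⇒< (suc n) n | suc n ≡ᵇ n | ≡ᵇ⇒≡ (suc n) n
... | true  | 1+n<n | _     | _      = contradiction (<⇒≤ (1+n<n _)) 1+n≰n
... | false | _     | true  | 1+n≡n = contradiction (1+n≡n _) 1+n≢n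
... | false | _     | false | _      = refl

module _ {n : ℕ} where

  -- idx a is the index of [n] ∖ {a}; idx₁₂, idx₃₄ those of [n] ∖ {1,2}, [n] ∖ {3,4} in the paper's
  -- numbering, i.e. of Fin n minus {0F, 1F}, {2F, 3F}.  Opaque, so that unification can recover n
  -- and a from idx {n} a.
  opaque
    private
      ι : Fin (suc (n + 2)) → Fin (n + 3)
      ι = cast (sym (+-suc n 2))

    idx₀ : Fin (n + 3)
    idx₀ = ι zero

    idx : Fin n → Fin (n + 3)
    idx a = ι (suc (a ↑ˡ 2))

    idx₁₂ : Fin (n + 3)
    idx₁₂ = ι (suc (n ↑ʳ 0F))

    idx₃₄ : Fin (n + 3)
    idx₃₄ = ι (suc (n ↑ʳ 1F))

    ∑-over-𝓕 : (f : Fin (n + 3) → ℕ) →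
               sum f ≡ f idx₀ + (∑[ a < n ] f (idx a) + (f idx₁₂ + (f idx₃₄ + 0)))
    ∑-over-𝓕 f = trans (∑-cast (sym (+-suc n 2)) f) (cong (f idx₀ +_) (∑-↑ n (f ∘ ι ∘ suc)))

    toℕ-idx₀ : toℕ idx₀ ≡ 0
    toℕ-idx₀ = toℕ-cast _ zero

    toℕ-idx : ∀ a → toℕ (idx a) ≡ suc (toℕ a)
    toℕ-idx a = trans (toℕ-cast _ _) (cong suc (toℕ-↑ˡ a 2))

    toℕ-idx₁₂ : toℕ idx₁₂ ≡ suc n
    toℕ-idx₁₂ = trans (toℕ-cast _ _) (cong suc (trans (toℕ-↑ʳ n 0F) (+-identityʳ n)))

    toℕ-idx₃₄ : toℕ idx₃₄ ≡ suc (suc n)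
    toℕ-idx₃₄ = trans (toℕ-cast _ _) (cong suc (trans (toℕ-↑ʳ n 1F) (+-comm n 1)))

  idx-injective : ∀ {a b} → idx a ≡ idx b → a ≡ b
  idx-injective {a} {b} eq = toℕ-injective (suc-injective (begin
    suc (toℕ a)  ≡⟨ toℕ-idx a ⟨
    toℕ (idx a)  ≡⟨ cong toℕ eq ⟩
    toℕ (idx b)  ≡⟨ toℕ-idx b ⟩
    suc (toℕ b)  ∎))
    where open ≡-Reasoning

  idx₀≢idx : ∀ {a} → idx₀ ≢ idx a
  idx₀≢idx {a} eq = case trans (sym toℕ-idx₀) (trans (cong toℕ eq) (toℕ-idx a)) of λ ()

  toℕ-beyond⇒≢idx : ∀ {j k a} → toℕ j ≡ suc k → n ≤ k → j ≢ idx a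
  toℕ-beyond⇒≢idx {j} {k} {a} toℕj≡1+k n≤k j≡idx[a] = <⇒≱ (toℕ<n a) (subst (n ≤_) (sym toℕa≡k) n≤k)
    where
    toℕa≡k : toℕ a ≡ k
    toℕa≡k = suc-injective (trans (sym (toℕ-idx a)) (trans (cong toℕ (sym j≡idx[a])) toℕj≡1+k))

  idx₁₂≢idx : ∀ {a} → idx₁₂ ≢ idx a
  idx₁₂≢idx = toℕ-beyond⇒≢idx toℕ-idx₁₂ ≤-refl

  idx₃₄≢idx : ∀ {a} → idx₃₄ ≢ idx a
  idx₃₄≢idx = toℕ-beyond⇒≢idx toℕ-idx₃₄ (n≤1+n n)

  lookup-𝓕 : ∀ j {k} x → toℕ j ≡ k → lookup (𝓕 n j) x ≡ fMem n k (toℕ x)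
  lookup-𝓕 j x refl = lookup∘tabulate (λ a → fMem n (toℕ j) (toℕ a)) x

  ∈𝓕-idx₀ : ∀ {x} → x ∈ 𝓕 n idx₀
  ∈𝓕-idx₀ {x} = lookup⇒[]= x (𝓕 n idx₀) (lookup-𝓕 idx₀ x toℕ-idx₀)

  lookup-𝓕-idx : ∀ a x → lookup (𝓕 n (idx a)) x ≡ not (toℕ x ≡ᵇ toℕ a)
  lookup-𝓕-idx a x = trans (lookup-𝓕 (idx a) x (toℕ-idx a)) (fMem-elem n (toℕ x) (toℕ<n a))

  ≢⇒∈𝓕-idx : ∀ {x a} → x ≢ a → x ∈ 𝓕 n (idx a)
  ≢⇒∈𝓕-idx {x} {a} x≢a = lookup⇒[]= x (𝓕 n (idx a))
    (trans (lookup-𝓕-idx a x) (cong not (≢⇒≡ᵇ≡false (x≢a ∘ toℕ-injective))))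

  ∉𝓕-idx : ∀ a → a ∉ 𝓕 n (idx a)
  ∉𝓕-idx a = lookup≡false⇒∉
    (trans (lookup-𝓕-idx a a) (cong not (Equivalence.to T-≡ (≡⇒≡ᵇ (toℕ a) (toℕ a) refl))))

  lookup-𝓕-idx₁₂ : ∀ x → lookup (𝓕 n idx₁₂) x ≡ (2 ≤ᵇ toℕ x)
  lookup-𝓕-idx₁₂ x = trans (lookup-𝓕 idx₁₂ x toℕ-idx₁₂) (fMem-n+1 n (toℕ x))

  lookup-𝓕-idx₃₄ : ∀ x → lookup (𝓕 n idx₃₄) x ≡ not ((toℕ x ≡ᵇ 2) ∨ (toℕ x ≡ᵇ 3))
  lookup-𝓕-idx₃₄ x = trans (lookup-𝓕 idx₃₄ x toℕ-idx₃₄) (fMem-n+2 n (toℕ x))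

module _ {m : ℕ} where

  ∉𝓕-idx₁₂ : (x : Fin (4 + m)) → x ∉ 𝓕 (4 + m) (idx₁₂ {4 + m}) → x ≡ 0F ⊎ x ≡ 1F
  ∉𝓕-idx₁₂ 0F _ = inj₁ refl
  ∉𝓕-idx₁₂ 1F _ = inj₂ refl
  ∉𝓕-idx₁₂ x@(suc (suc _)) x∉ = contradiction (lookup⇒[]= _ (𝓕 (4 + m) (idx₁₂ {4 + m})) (lookup-𝓕-idx₁₂ x)) x∉

  ∉𝓕-idx₃₄ : (x : Fin (4 + m)) → x ∉ 𝓕 (4 + m) (idx₃₄ {4 + m}) → x ≡ 2F ⊎ x ≡ 3F
  ∉𝓕-idx₃₄ 2F _  = inj₁ refl
  ∉𝓕-idx₃₄ 3F _  = inj₂ refl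
  ∉𝓕-idx₃₄ 0F x∉ = contradiction (lookup⇒[]= _ (𝓕 (4 + m) (idx₃₄ {4 + m})) (lookup-𝓕-idx₃₄ 0F)) x∉
  ∉𝓕-idx₃₄ 1F x∉ = contradiction (lookup⇒[]= _ (𝓕 (4 + m) (idx₃₄ {4 + m})) (lookup-𝓕-idx₃₄ 1F)) x∉
  ∉𝓕-idx₃₄ x@(suc (suc (suc (suc _)))) x∉ =
    contradiction (lookup⇒[]= _ (𝓕 (4 + m) (idx₃₄ {4 + m})) (lookup-𝓕-idx₃₄ x)) x∉

module _ {n} {S : Fin (n + 3) → Subset n} (R : ReimerConditions S (𝓕 n)) where

  ∉⇒⊆𝓕-idx : ∀ {a} {p : Subset n} → a ∉ p → p ⊆ 𝓕 n (idx a)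
  ∉⇒⊆𝓕-idx a∉p {x} x∈p = ≢⇒∈𝓕-idx λ { refl → a∉p x∈p }

  ∉S-idx : ∀ a → a ∉ S (idx a)
  ∉S-idx a = ∉𝓕-idx a ∘ proj₁ R (idx a)

  S-idx₀-full : ∀ a → a ∈ S idx₀
  S-idx₀-full a with a ∈? S idx₀
  ... | yes a∈S₀ = a∈S₀
  ... | no  a∉S₀ = ⊥-elim (reimer-⊈ R idx₀≢idx (λ _ → ∈𝓕-idx₀) (∉⇒⊆𝓕-idx a∉S₀))

  S-idx-total : ∀ {a b} → a ≢ b → b ∈ S (idx a) ⊎ a ∈ S (idx b)
  S-idx-total {a} {b} a≢b with b ∈? S (idx a) | a ∈? S (idx b)
  ... | yes b∈Sa | _        = inj₁ b∈Sa
  ... | no  _    | yes a∈Sb = inj₂ a∈Sb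
  ... | no  b∉Sa | no  a∉Sb =
    ⊥-elim (reimer-⊈ R (a≢b ∘ idx-injective) (∉⇒⊆𝓕-idx a∉Sb) (∉⇒⊆𝓕-idx b∉Sa))

  -- S k ⊆ 𝓕 k ⊆ 𝓕 (idx a), so S (idx a) ⊈ 𝓕 k: it meets the complement {a, b} of 𝓕 k, but not in a.
  ∈S-idx-partner : ∀ {k a b} → k ≢ idx a → a ∉ 𝓕 n k → (∀ x → x ∉ 𝓕 n k → x ≡ a ⊎ x ≡ b) →
                   b ∈ S (idx a)
  ∈S-idx-partner {k} {a} {b} k≢idx[a] a∉𝓕k ∉𝓕k⇒ with b ∈? S (idx a)
  ... | yes b∈Sa = b∈Sa
  ... | no  b∉Sa = ⊥-elim (reimer-⊈ R k≢idx[a] Sa⊆𝓕k (∉⇒⊆𝓕-idx (a∉𝓕k ∘ proj₁ R k)))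
    where
    Sa⊆𝓕k : S (idx a) ⊆ 𝓕 n k
    Sa⊆𝓕k {x} x∈Sa with x ∈? 𝓕 n k
    ... | yes x∈𝓕k = x∈𝓕k
    ... | no  x∉𝓕k = [ (λ { refl → contradiction x∈Sa (∉S-idx a) }) , (λ { refl → contradiction x∈Sa b∉Sa }) ]
                        (∉𝓕k⇒ x x∉𝓕k)

module _ {m} {S : Fin (4 + m + 3) → Subset (4 + m)} (R : ReimerConditions S (𝓕 (4 + m))) where

  2∑∣S-idx∣≥ : 4 * (4 + m) + m * (3 + m) ≤ 2 * ∑[ a < 4 + m ] ∣ S (idx a) ∣
  2∑∣S-idx∣≥ = begin
    4 * (4 + m) + m * (3 + m)              ≡⟨ regroup (4 + m) (m * (3 + m)) ⟩
    N + (N + (N + (N + m * (3 + m))))      ≤⟨ +-mono-≤ (partners 1∈T0 0∈T1)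
                                               (+-mono-≤ (partners 0∈T1 1∈T0)
                                               (+-mono-≤ (partners 3∈T2 2∈T3)
                                               (+-mono-≤ (partners 2∈T3 3∈T2) others))) ⟩
    sum (incidences T)                     ≡⟨ ∑incidences≡ T ⟩
    2 * ∑[ a < 4 + m ] ∣ T a ∣             ∎
    where
    open ≤-Reasoning
    N = 4 + m
    T : Fin N → Subset N
    T a = S (idx a)
    regroup : ∀ k r → 4 * k + r ≡ k + (k + (k + (k + r)))
    regroup = solve-∀
    partners : ∀ {a c} → c ∈ T a → a ∈ T c → N ≤ incidences T a
    partners {a} {c} c∈Ta a∈Tc = mutual⇒n<incidences T (S-idx-total R) c≢a c∈Ta a∈Tc
      where
      c≢a : c ≢ a
      c≢a refl = ∉S-idx R a c∈Ta
    others : m * (3 + m) ≤ ∑[ a < m ] incidences T (suc (suc (suc (suc a))))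
    others = subst (_≤ ∑[ a < m ] incidences T (suc (suc (suc (suc a))))) (∑-const m (3 + m))
      (∑-mono-≤ (λ a → n≤incidences T (S-idx-total R) (suc (suc (suc (suc a))))))
    1∈T0 : 1F ∈ T 0F
    1∈T0 = ∈S-idx-partner R idx₁₂≢idx (lookup≡false⇒∉ (lookup-𝓕-idx₁₂ 0F)) ∉𝓕-idx₁₂
    0∈T1 : 0F ∈ T 1F
    0∈T1 = ∈S-idx-partner R idx₁₂≢idx (lookup≡false⇒∉ (lookup-𝓕-idx₁₂ 1F)) (λ x → swap ∘ ∉𝓕-idx₁₂ x)
    3∈T2 : 3F ∈ T 2F
    3∈T2 = ∈S-idx-partner R idx₃₄≢idx (lookup≡false⇒∉ (lookup-𝓕-idx₃₄ 2F)) ∉𝓕-idx₃₄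
    2∈T3 : 2F ∈ T 3F
    2∈T3 = ∈S-idx-partner R idx₃₄≢idx (lookup≡false⇒∉ (lookup-𝓕-idx₃₄ 3F)) (λ x → swap ∘ ∉𝓕-idx₃₄ x)

degree-total-arith : ∀ x {s₀ t s₁ s₂} → 4 + 4 * x ≤ s₀ → 4 * (4 + 4 * x) + 4 * x * (3 + 4 * x) ≤ 2 * t →
                     x ≤ s₁ → x ≤ s₂ → (4 + 4 * x) * (3 + 2 * x) ≤ s₀ + (t + (s₁ + (s₂ + 0)))
degree-total-arith x {s₀} {t} {s₁} {s₂} s₀≥ 2t≥ s₁≥ s₂≥ = *-cancelˡ-≤ 2 (begin
  2 * ((4 + 4 * x) * (3 + 2 * x))
    ≡⟨ expand x ⟩
  2 * (4 + 4 * x) + ((4 * (4 + 4 * x) + 4 * x * (3 + 4 * x)) + ((x + x) + (x + x)))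
    ≤⟨ +-mono-≤ (*-monoʳ-≤ 2 s₀≥) (+-mono-≤ 2t≥ (+-mono-≤ (+-mono-≤ s₁≥ s₁≥) (+-mono-≤ s₂≥ s₂≥))) ⟩
  2 * s₀ + (2 * t + ((s₁ + s₁) + (s₂ + s₂)))
    ≡⟨ collect s₀ t s₁ s₂ ⟩
  2 * (s₀ + (t + (s₁ + (s₂ + 0)))) ∎)
  where
  open ≤-Reasoning
  expand : ∀ x → 2 * ((4 + 4 * x) * (3 + 2 * x)) ≡
                 2 * (4 + 4 * x) + ((4 * (4 + 4 * x) + 4 * x * (3 + 4 * x)) + ((x + x) + (x + x)))
  expand = solve-∀
  collect : ∀ s₀ t s₁ s₂ → 2 * s₀ + (2 * t + ((s₁ + s₁) + (s₂ + s₂))) ≡ 2 * (s₀ + (t + (s₁ + (s₂ + 0))))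
  collect = solve-∀

∑degree≥ : ∀ {x} {S : Fin (4 + 4 * x + 3) → Subset (4 + 4 * x)} → ReimerConditions S (𝓕 (4 + 4 * x)) →
           (∀ j → x ≤ ∣ S j ∣) → (4 + 4 * x) * (3 + 2 * x) ≤ ∑[ a < 4 + 4 * x ] degree S a
∑degree≥ {x} {S} R x≤∣S∣ = subst ((4 + 4 * x) * (3 + 2 * x) ≤_) ∑∣S∣≡∑degree
  (degree-total-arith x {t = ∑[ a < N ] ∣ S (idx a) ∣} ∣S-idx₀∣≥ (2∑∣S-idx∣≥ R)
                      (x≤∣S∣ (idx₁₂ {N})) (x≤∣S∣ (idx₃₄ {N})))
  where
  N = 4 + 4 * x
  ∣S-idx₀∣≥ : N ≤ ∣ S (idx₀ {N}) ∣
  ∣S-idx₀∣≥ = subst (_≤ ∣ S (idx₀ {N}) ∣) (∣⊤∣≡n N) (p⊆q⇒∣p∣≤∣q∣ {p = ⊤} (λ {a} _ → S-idx₀-full R a))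
  ∑∣S∣≡∑degree : ∣ S (idx₀ {N}) ∣ + (∑[ a < N ] ∣ S (idx a) ∣ + (∣ S (idx₁₂ {N}) ∣ + (∣ S (idx₃₄ {N}) ∣ + 0)))
               ≡ ∑[ a < N ] degree S a
  ∑∣S∣≡∑degree = sym (trans (∑degree≡∑∣S∣ S) (∑-over-𝓕 {N} (λ j → ∣ S j ∣)))

¬Abundant⇒degree≤ : ∀ {n m k} {S : Fin m → Subset n} → m ≡ suc (2 * k) → ¬ Abundant S → ∀ a → degree S a ≤ k
¬Abundant⇒degree≤ {k = k} {S} refl ¬abundant a = ≮⇒≥ λ k<deg →
  ¬abundant (a , ≤-trans (n≤1+n _) (subst (_≤ 2 * degree S a) (*-suc 2 k) (*-monoʳ-≤ 2 k<deg)))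

mainTheorem7 : (n : ℕ) → 2 ∣ n → 4 ≤ n →
    (S : Fin (n + 3) → Subset n) →
    Injective _≡_ _≡_ S →
    ReimerConditions S (𝓕 n) →
    ¬ Abundant S →
    (x : ℕ) → (∃ λ j → ∣ S j ∣ ≡ x) → ((j : Fin (n + 3)) → x ≤ ∣ S j ∣) →
    n ≡ 4 * x + 4 →
    (a : Fin n) → degree S a ≡ n / 2 + 1
mainTheorem7 n _ _ S _ R ¬abundant x _ x≤∣S∣ n≡4x+4 with trans n≡4x+4 (+-comm (4 * x) 4)
... | refl = λ a → begin
  degree S a            ≡⟨ ≤-∑-saturated (¬Abundant⇒degree≤ {S = S} (size≡ x) ¬abundant)
                                       (∑degree≥ R x≤∣S∣) a ⟩
  3 + 2 * x             ≡⟨ half x ⟨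
  (4 + 4 * x) / 2 + 1   ∎
  where
  open ≡-Reasoning
  size≡ : ∀ x → 4 + 4 * x + 3 ≡ suc (2 * (3 + 2 * x))
  size≡ = solve-∀
  half : ∀ x → (4 + 4 * x) / 2 + 1 ≡ 3 + 2 * x
  half x = begin
    (4 + 4 * x) / 2 + 1        ≡⟨ cong (λ k → k / 2 + 1) (double x) ⟩
    (2 + 2 * x) * 2 / 2 + 1    ≡⟨ cong (_+ 1) (m*n/n≡m (2 + 2 * x) 2) ⟩
    2 + 2 * x + 1              ≡⟨ +-comm (2 + 2 * x) 1 ⟩
    3 + 2 * x                  ∎
    where
    double : ∀ x → 4 + 4 * x ≡ (2 + 2 * x) * 2
    double = solve-∀
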